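{- Let $d,n\in\mathbb{N}$ with $n\le d$. Then any two maximal $d$-caps in $\mathbb{F}_3^n$ are affinely equivalent.
   Context: $\mathbb{F}_3^n$ denotes $n$-dimensional affine space over the field with three elements. A $k$-dimensional flat is a $k$-dimensional affine subspace. For $d\in\mathbb{N}$, a subset $C\subseteq\mathbb{F}_3^n$ is a $d$-cap if, for each $k=1,\dots,d$, no $k+2$ points of $C$ lie on a $k$-dimensional flat (equivalently, every subset of $C$ of size at most $d+2$ is affinely independent). A $d$-cap is maximal if it has the largest possible cardinality among $d$-caps in $\mathbb{F}_3^n$. Two subsets $C,D$ are affinely equivalent if there is an invertible affine transformation $T$ of $\mathbb{F}_3^n$ with $T(C)=D$. -}

module Defs where

open import Data.Nat using (ℕ; _≤_; _+_)
open import Data.Fin using (Fin; zero; suc)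
open import Data.Vec using (Vec; []; _∷_; zipWith; map; replicate; foldr)
open import Data.List using (List; length) renaming ([] to []ₗ; _∷_ to _∷ₗ_)
open import Data.List.Membership.Propositional using (_∈_)
open import Data.List.Relation.Unary.All using (All)
open import Data.List.Relation.Unary.Unique.Propositional using (Unique)
open import Data.Product using (Σ; _×_; ∃)
open import Relation.Binary.PropositionalEquality using (_≡_)
open import Function.Bundles using (_⇔_)

F₃ : Set
F₃ = Fin 3

0F 1F 2F : F₃
0F = zero
1F = suc zero
2F = suc (suc zero)

_+₃_ : F₃ → F₃ → F₃
zero +₃ y = y
suc zero +₃ zero = 1F
suc zero +₃ suc zero = 2F
suc zero +₃ suc (suc zero) = 0F
suc (suc zero) +₃ zero = 2F
suc (suc zero) +₃ suc zero = 0F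
suc (suc zero) +₃ suc (suc zero) = 1F

_*₃_ : F₃ → F₃ → F₃
zero *₃ y = 0F
suc zero *₃ y = y
suc (suc zero) *₃ zero = 0F
suc (suc zero) *₃ suc zero = 2F
suc (suc zero) *₃ suc (suc zero) = 1F

Point : ℕ → Set
Point n = Vec F₃ n

0V : ∀ {n} → Point n
0V = replicate _ 0F

_⊕_ : ∀ {n} → Point n → Point n → Point n
_⊕_ = zipWith _+₃_

_⊙_ : ∀ {n} → F₃ → Point n → Point n
c ⊙ v = map (c *₃_) v

sumF : List F₃ → F₃
sumF []ₗ = 0F
sumF (c ∷ₗ cs) = c +₃ sumF cs

-- Linear combination Σ cᵢ pᵢ (extra entries on either side ignored; used with equal lengths)
comb : ∀ {n} → List F₃ → List (Point n) → Point n
comb (c ∷ₗ cs) (p ∷ₗ ps) = (c ⊙ p) ⊕ comb cs ps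
comb _ _ = 0V

AffinelyIndependent : ∀ {n} → List (Point n) → Set
AffinelyIndependent ps =
  ∀ (cs : List F₃) → length cs ≡ length ps → sumF cs ≡ 0F → comb cs ps ≡ 0V →
  All (_≡ 0F) cs

-- A subset of F₃ⁿ is represented by a duplicate-free list of points;
-- its cardinality is the length.
-- d-cap: every subset of C of size at most d+2 is affinely independent.
IsCap : ℕ → (n : ℕ) → List (Point n) → Set
IsCap d n C =
  Unique C ×
  (∀ (S : List (Point n)) → Unique S → (∀ {x} → x ∈ S → x ∈ C) →
     length S ≤ d + 2 → AffinelyIndependent S)

IsMaximalCap : ℕ → (n : ℕ) → List (Point n) → Set
IsMaximalCap d n C =
  IsCap d n C × (∀ (D : List (Point n)) → IsCap d n D → length D ≤ length C)

Matrix : ℕ → Set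
Matrix n = Vec (Vec F₃ n) n

dot : ∀ {n} → Vec F₃ n → Vec F₃ n → F₃
dot u v = foldr _ _+₃_ 0F (zipWith _*₃_ u v)

_▸_ : ∀ {n} → Matrix n → Point n → Point n
A ▸ x = map (λ row → dot row x) A

InvertibleMatrix : ∀ {n} → Matrix n → Set
InvertibleMatrix {n} A =
  Σ (Matrix n) λ B → (∀ x → B ▸ (A ▸ x) ≡ x) × (∀ x → A ▸ (B ▸ x) ≡ x)

record AffineTransformation (n : ℕ) : Set where
  field
    A : Matrix n
    b : Point n
    invertible : InvertibleMatrix A

  apply : Point n → Point n
  apply x = (A ▸ x) ⊕ b

AffinelyEquivalent : ∀ {n} → List (Point n) → List (Point n) → Set
AffinelyEquivalent {n} C D =
  Σ (AffineTransformation n) λ T →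
    ∀ (x : Point n) →
      (x ∈ D) ⇔ (∃ λ y → y ∈ C × AffineTransformation.apply T y ≡ x)

-- Any n + 2 points of F₃ⁿ are affinely dependent: lifting them to (1, p) in F₃ⁿ⁺¹, there
-- are 3ⁿ⁺² coefficient vectors but only 3ⁿ⁺¹ values of the linear combination, so two
-- distinct vectors give the same value and their difference is a dependence.  When n ≤ d a
-- d-cap has all its subsets of size ≤ n + 2 independent, hence at most n + 1 points, and the
-- standard frame {0, e₁, …, eₙ} is a d-cap of that size.  So a maximal d-cap is an affine
-- frame c₀, …, cₙ: the differences cᵢ − c₀ form a basis of F₃ⁿ.  For two frames, the linear
-- map sending cᵢ − c₀ to dᵢ − d₀, followed by the translation taking c₀ to d₀, maps one
-- onto the other.

module Submission where

open import Defs
open import Data.Bool using (if_then_else_)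
open import Data.Fin using (Fin; zero; suc)
open import Data.Fin.Properties using (all?; _≟_; pigeonhole; <⇒≢)
open import Data.List as L using (List)
open import Data.List.Membership.Propositional using (_∈_)
open import Data.List.Membership.Propositional.Properties using (∈-tabulate⁻; ∈-map⁺; ∈-map⁻)
import Data.List.Properties as Listₚ
open import Data.List.Relation.Unary.All as All using (All) renaming ([] to []ᵃ; _∷_ to _∷ᵃ_)
import Data.List.Relation.Unary.All.Properties as Allₚ
open import Data.List.Relation.Unary.AllPairs using () renaming (_∷_ to _∷ᵘ_)
open import Data.List.Relation.Unary.Any using (here; there)
open import Data.List.Relation.Unary.Unique.Propositional using (Unique)
import Data.List.Relation.Unary.Unique.Propositional.Properties as Uniqueₚ
open import Data.Nat as ℕ using (ℕ; _≤_; _<_; _^_; z≤n; s≤s)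
import Data.Nat.Properties as ℕₚ
open import Data.Product using (∃; _×_; _,_; proj₁; proj₂)
open import Data.Vec as V using (Vec; []; _∷_; toList)
import Data.Vec.Properties as Vecₚ
open import Data.Vec.Recursive using (Fin[m^n]↔Fin[m]^n)
open import Data.Vec.Recursive.Properties using (↔Vec)
open import Function using (_∘_)
open import Function.Bundles using (_↔_; Inverse; mk⇔)
open import Function.Properties.Inverse using (↔-sym; ↔-trans)
open import Relation.Binary.PropositionalEquality
open import Relation.Nullary using (¬_; Dec; yes; no; does; contradiction)
open import Relation.Nullary.Decidable using (from-yes; dec-true; dec-false)

private
  variable
    d m n : ℕ
    i j : Fin n

+₃-assoc : ∀ a b c → (a +₃ b) +₃ c ≡ a +₃ (b +₃ c)
+₃-assoc = from-yes (all? λ a → all? λ b → all? λ c → (a +₃ b) +₃ c ≟ a +₃ (b +₃ c))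

+₃-comm : ∀ a b → a +₃ b ≡ b +₃ a
+₃-comm = from-yes (all? λ a → all? λ b → a +₃ b ≟ b +₃ a)

+₃-identityʳ : ∀ a → a +₃ 0F ≡ a
+₃-identityʳ = from-yes (all? λ a → a +₃ 0F ≟ a)

+₃-inverseˡ : ∀ a → (2F *₃ a) +₃ a ≡ 0F
+₃-inverseˡ = from-yes (all? λ a → (2F *₃ a) +₃ a ≟ 0F)

+₃-inverseʳ : ∀ a → a +₃ (2F *₃ a) ≡ 0F
+₃-inverseʳ = from-yes (all? λ a → a +₃ (2F *₃ a) ≟ 0F)

*₃-assoc : ∀ a b c → (a *₃ b) *₃ c ≡ a *₃ (b *₃ c)
*₃-assoc = from-yes (all? λ a → all? λ b → all? λ c → (a *₃ b) *₃ c ≟ a *₃ (b *₃ c))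

*₃-comm : ∀ a b → a *₃ b ≡ b *₃ a
*₃-comm = from-yes (all? λ a → all? λ b → a *₃ b ≟ b *₃ a)

*₃-distribˡ-+₃ : ∀ a b c → a *₃ (b +₃ c) ≡ (a *₃ b) +₃ (a *₃ c)
*₃-distribˡ-+₃ =
  from-yes (all? λ a → all? λ b → all? λ c → a *₃ (b +₃ c) ≟ (a *₃ b) +₃ (a *₃ c))

*₃-distribʳ-+₃ : ∀ a b c → (b +₃ c) *₃ a ≡ (b *₃ a) +₃ (c *₃ a)
*₃-distribʳ-+₃ =
  from-yes (all? λ a → all? λ b → all? λ c → (b +₃ c) *₃ a ≟ (b *₃ a) +₃ (c *₃ a))

*₃-zeroʳ : ∀ a → a *₃ 0F ≡ 0F
*₃-zeroʳ = from-yes (all? λ a → a *₃ 0F ≟ 0F)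

*₃-identityʳ : ∀ a → a *₃ 1F ≡ a
*₃-identityʳ = from-yes (all? λ a → a *₃ 1F ≟ a)

*₃-selfInverse : ∀ a → a ≢ 0F → a *₃ a ≡ 1F
*₃-selfInverse zero a≢0 = contradiction refl a≢0
*₃-selfInverse (suc zero) _ = refl
*₃-selfInverse (suc (suc zero)) _ = refl

_⊖_ : Point n → Point n → Point n
u ⊖ v = u ⊕ (2F ⊙ v)

⊕-assoc : (u v w : Point n) → (u ⊕ v) ⊕ w ≡ u ⊕ (v ⊕ w)
⊕-assoc = Vecₚ.zipWith-assoc +₃-assoc

⊕-comm : (u v : Point n) → u ⊕ v ≡ v ⊕ u
⊕-comm = Vecₚ.zipWith-comm +₃-comm

⊕-identityˡ : (u : Point n) → 0V ⊕ u ≡ u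
⊕-identityˡ = Vecₚ.zipWith-identityˡ λ _ → refl

⊕-identityʳ : (u : Point n) → u ⊕ 0V ≡ u
⊕-identityʳ = Vecₚ.zipWith-identityʳ +₃-identityʳ

⊖-inverseʳ : (u : Point n) → u ⊖ u ≡ 0V
⊖-inverseʳ = Vecₚ.zipWith-inverseʳ +₃-inverseʳ

⊕-interchange : (u v w x : Point n) → (u ⊕ v) ⊕ (w ⊕ x) ≡ (u ⊕ w) ⊕ (v ⊕ x)
⊕-interchange u v w x = begin
  (u ⊕ v) ⊕ (w ⊕ x) ≡⟨ ⊕-assoc u v (w ⊕ x) ⟩
  u ⊕ (v ⊕ (w ⊕ x)) ≡⟨ cong (u ⊕_) (sym (⊕-assoc v w x)) ⟩
  u ⊕ ((v ⊕ w) ⊕ x) ≡⟨ cong (λ y → u ⊕ (y ⊕ x)) (⊕-comm v w) ⟩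
  u ⊕ ((w ⊕ v) ⊕ x) ≡⟨ cong (u ⊕_) (⊕-assoc w v x) ⟩
  u ⊕ (w ⊕ (v ⊕ x)) ≡⟨ sym (⊕-assoc u w (v ⊕ x)) ⟩
  (u ⊕ w) ⊕ (v ⊕ x) ∎
  where open ≡-Reasoning

⊙-distribˡ : ∀ a (u v : Point n) → a ⊙ (u ⊕ v) ≡ (a ⊙ u) ⊕ (a ⊙ v)
⊙-distribˡ a [] [] = refl
⊙-distribˡ a (b ∷ u) (c ∷ v) = cong₂ _∷_ (*₃-distribˡ-+₃ a b c) (⊙-distribˡ a u v)

⊙-distribʳ : ∀ a b (u : Point n) → (a +₃ b) ⊙ u ≡ (a ⊙ u) ⊕ (b ⊙ u)
⊙-distribʳ a b [] = refl
⊙-distribʳ a b (c ∷ u) = cong₂ _∷_ (*₃-distribʳ-+₃ c a b) (⊙-distribʳ a b u)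

⊙-assoc : ∀ a b (u : Point n) → (a *₃ b) ⊙ u ≡ a ⊙ (b ⊙ u)
⊙-assoc a b [] = refl
⊙-assoc a b (c ∷ u) = cong₂ _∷_ (*₃-assoc a b c) (⊙-assoc a b u)

⊙-identityˡ : (u : Point n) → 1F ⊙ u ≡ u
⊙-identityˡ = Vecₚ.map-id

⊙-zeroˡ : (u : Point n) → 0F ⊙ u ≡ 0V
⊙-zeroˡ [] = refl
⊙-zeroˡ (c ∷ u) = cong (0F ∷_) (⊙-zeroˡ u)

⊙-zeroʳ : ∀ a → a ⊙ 0V {n} ≡ 0V
⊙-zeroʳ {n} a = trans (Vecₚ.map-replicate (a *₃_) 0F n) (cong (V.replicate n) (*₃-zeroʳ a))

⊕-inverse-unique : (u v : Point n) → u ⊕ v ≡ 0V → u ≡ 2F ⊙ v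
⊕-inverse-unique u v u⊕v≡0 = begin
  u                    ≡⟨ sym (⊕-identityʳ u) ⟩
  u ⊕ 0V               ≡⟨ cong (u ⊕_) (sym (⊖-inverseʳ v)) ⟩
  u ⊕ (v ⊕ (2F ⊙ v))   ≡⟨ sym (⊕-assoc u v _) ⟩
  (u ⊕ v) ⊕ (2F ⊙ v)   ≡⟨ cong (_⊕ (2F ⊙ v)) u⊕v≡0 ⟩
  0V ⊕ (2F ⊙ v)        ≡⟨ ⊕-identityˡ _ ⟩
  2F ⊙ v               ∎
  where open ≡-Reasoning

⊖≡0⇒≡ : (u v : Point n) → u ⊖ v ≡ 0V → u ≡ v
⊖≡0⇒≡ u v u⊖v≡0 = begin
  u                  ≡⟨ ⊕-inverse-unique u (2F ⊙ v) u⊖v≡0 ⟩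
  2F ⊙ (2F ⊙ v)      ≡⟨ sym (⊙-assoc 2F 2F v) ⟩
  1F ⊙ v             ≡⟨ ⊙-identityˡ v ⟩
  v                  ∎
  where open ≡-Reasoning

⊕-⊖-cancel : (u v w : Point n) → (u ⊕ v) ⊕ (w ⊖ v) ≡ u ⊕ w
⊕-⊖-cancel u v w = begin
  (u ⊕ v) ⊕ (w ⊖ v)   ≡⟨ ⊕-interchange u v w (2F ⊙ v) ⟩
  (u ⊕ w) ⊕ (v ⊖ v)   ≡⟨ cong ((u ⊕ w) ⊕_) (⊖-inverseʳ v) ⟩
  (u ⊕ w) ⊕ 0V        ≡⟨ ⊕-identityʳ (u ⊕ w) ⟩
  u ⊕ w               ∎
  where open ≡-Reasoning

⊖-⊕-cancel : (u v : Point n) → (u ⊖ v) ⊕ v ≡ u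
⊖-⊕-cancel u v = begin
  (u ⊖ v) ⊕ v          ≡⟨ ⊕-assoc u (2F ⊙ v) v ⟩
  u ⊕ ((2F ⊙ v) ⊕ v)   ≡⟨ cong (u ⊕_) (⊕-comm (2F ⊙ v) v) ⟩
  u ⊕ (v ⊖ v)          ≡⟨ cong (u ⊕_) (⊖-inverseʳ v) ⟩
  u ⊕ 0V               ≡⟨ ⊕-identityʳ u ⟩
  u                    ∎
  where open ≡-Reasoning

-- Linear combinations and dependence

combᵥ : Vec F₃ m → List (Point n) → Point n
combᵥ x = comb (toList x)

combᵥ-⊕ : (x y : Vec F₃ m) (ps : List (Point n)) →
  combᵥ (x ⊕ y) ps ≡ combᵥ x ps ⊕ combᵥ y ps
combᵥ-⊕ [] [] ps = sym (⊕-identityˡ 0V)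
combᵥ-⊕ (a ∷ x) (b ∷ y) L.[] = sym (⊕-identityˡ 0V)
combᵥ-⊕ (a ∷ x) (b ∷ y) (p L.∷ ps) = begin
  ((a +₃ b) ⊙ p) ⊕ combᵥ (x ⊕ y) ps
    ≡⟨ cong₂ _⊕_ (⊙-distribʳ a b p) (combᵥ-⊕ x y ps) ⟩
  ((a ⊙ p) ⊕ (b ⊙ p)) ⊕ (combᵥ x ps ⊕ combᵥ y ps)
    ≡⟨ ⊕-interchange _ _ _ _ ⟩
  ((a ⊙ p) ⊕ combᵥ x ps) ⊕ ((b ⊙ p) ⊕ combᵥ y ps) ∎
  where open ≡-Reasoning

combᵥ-⊙ : ∀ a (x : Vec F₃ m) (ps : List (Point n)) →
  combᵥ (a ⊙ x) ps ≡ a ⊙ combᵥ x ps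
combᵥ-⊙ a [] ps = sym (⊙-zeroʳ a)
combᵥ-⊙ a (b ∷ x) L.[] = sym (⊙-zeroʳ a)
combᵥ-⊙ a (b ∷ x) (p L.∷ ps) = begin
  ((a *₃ b) ⊙ p) ⊕ combᵥ (a ⊙ x) ps   ≡⟨ cong₂ _⊕_ (⊙-assoc a b p) (combᵥ-⊙ a x ps) ⟩
  (a ⊙ (b ⊙ p)) ⊕ (a ⊙ combᵥ x ps)    ≡⟨ sym (⊙-distribˡ a _ _) ⟩
  a ⊙ ((b ⊙ p) ⊕ combᵥ x ps)          ∎
  where open ≡-Reasoning

combᵥ-⊖ : (x y : Vec F₃ m) (ps : List (Point n)) →
  combᵥ (x ⊖ y) ps ≡ combᵥ x ps ⊖ combᵥ y ps
combᵥ-⊖ x y ps = trans (combᵥ-⊕ x (2F ⊙ y) ps) (cong (combᵥ x ps ⊕_) (combᵥ-⊙ 2F y ps))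

combᵥ-0V : ∀ m (ps : List (Point n)) → combᵥ (0V {m}) ps ≡ 0V
combᵥ-0V ℕ.zero ps = refl
combᵥ-0V (ℕ.suc m) L.[] = refl
combᵥ-0V (ℕ.suc m) (p L.∷ ps) =
  trans (cong₂ _⊕_ (⊙-zeroˡ p) (combᵥ-0V m ps)) (⊕-identityˡ 0V)

comb-map-∷ : ∀ a (cs : List F₃) (ps : List (Point n)) → L.length cs ≡ L.length ps →
  comb cs (L.map (a ∷_) ps) ≡ (a *₃ sumF cs) ∷ comb cs ps
comb-map-∷ a L.[] L.[] _ = cong (_∷ 0V) (sym (*₃-zeroʳ a))
comb-map-∷ a (c L.∷ cs) (p L.∷ ps) |cs|≡|ps| =
  trans (cong ((c ⊙ (a ∷ p)) ⊕_) (comb-map-∷ a cs ps (ℕₚ.suc-injective |cs|≡|ps|)))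
        (cong (_∷ _) (trans (cong (_+₃ _) (*₃-comm c a))
                            (sym (*₃-distribˡ-+₃ a c (sumF cs)))))

comb-map-⊕ʳ : (cs : List F₃) (ps : List (Point n)) (q : Point n) →
  L.length cs ≡ L.length ps →
  comb cs (L.map (_⊕ q) ps) ≡ comb cs ps ⊕ (sumF cs ⊙ q)
comb-map-⊕ʳ L.[] L.[] q _ = sym (trans (cong (0V ⊕_) (⊙-zeroˡ q)) (⊕-identityˡ 0V))
comb-map-⊕ʳ (c L.∷ cs) (p L.∷ ps) q |cs|≡|ps| = begin
  (c ⊙ (p ⊕ q)) ⊕ comb cs (L.map (_⊕ q) ps)
    ≡⟨ cong₂ _⊕_ (⊙-distribˡ c p q) (comb-map-⊕ʳ cs ps q (ℕₚ.suc-injective |cs|≡|ps|)) ⟩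
  ((c ⊙ p) ⊕ (c ⊙ q)) ⊕ (comb cs ps ⊕ (sumF cs ⊙ q))
    ≡⟨ ⊕-interchange _ _ _ _ ⟩
  ((c ⊙ p) ⊕ comb cs ps) ⊕ ((c ⊙ q) ⊕ (sumF cs ⊙ q))
    ≡⟨ cong (_ ⊕_) (sym (⊙-distribʳ c (sumF cs) q)) ⟩
  ((c ⊙ p) ⊕ comb cs ps) ⊕ ((c +₃ sumF cs) ⊙ q) ∎
  where open ≡-Reasoning

allZero⇒≡0V : (x : Vec F₃ m) → All (_≡ 0F) (toList x) → x ≡ 0V
allZero⇒≡0V [] _ = refl
allZero⇒≡0V (a ∷ x) (refl ∷ᵃ zeros) = cong (0F ∷_) (allZero⇒≡0V x zeros)

sumF-allZero : {cs : List F₃} → All (_≡ 0F) cs → sumF cs ≡ 0F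
sumF-allZero []ᵃ = refl
sumF-allZero (refl ∷ᵃ zeros) = sumF-allZero zeros

vectorCode : ∀ m → Vec F₃ m ↔ Fin (3 ^ m)
vectorCode m = ↔-sym (↔-trans (Fin[m^n]↔Fin[m]^n 3 m) (↔Vec m))

linearlyDependent : (vs : List (Point n)) → n < L.length vs →
  ∃ λ (x : Vec F₃ (L.length vs)) → x ≢ 0V × combᵥ x vs ≡ 0V
linearlyDependent {n} vs n<m
  with pigeonhole (ℕₚ.^-monoʳ-< 3 (s≤s (s≤s z≤n)) n<m)
                  (Inverse.to (vectorCode n) ∘ (λ x → combᵥ x vs)
                                             ∘ Inverse.from (vectorCode (L.length vs)))
... | i , j , i<j , same = x ⊖ y , x⊖y≢0V , comb[x⊖y]≡0V
  where
    open Inverse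
    open ≡-Reasoning
    pointCode = vectorCode n
    coefficientCode = vectorCode (L.length vs)
    x y : Vec F₃ (L.length vs)
    x = from coefficientCode i
    y = from coefficientCode j
    x⊖y≢0V : x ⊖ y ≢ 0V
    x⊖y≢0V x⊖y≡0V = <⇒≢ i<j (begin
      i                       ≡⟨ sym (strictlyInverseˡ coefficientCode i) ⟩
      to coefficientCode x    ≡⟨ cong (to coefficientCode) (⊖≡0⇒≡ x y x⊖y≡0V) ⟩
      to coefficientCode y    ≡⟨ strictlyInverseˡ coefficientCode j ⟩
      j                       ∎)
    combᵥ-x≡combᵥ-y : combᵥ x vs ≡ combᵥ y vs
    combᵥ-x≡combᵥ-y = begin
      combᵥ x vs                                  ≡⟨ sym (strictlyInverseʳ pointCode _) ⟩
      from pointCode (to pointCode (combᵥ x vs))  ≡⟨ cong (from pointCode) same ⟩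
      from pointCode (to pointCode (combᵥ y vs))  ≡⟨ strictlyInverseʳ pointCode _ ⟩
      combᵥ y vs                                  ∎
    comb[x⊖y]≡0V : combᵥ (x ⊖ y) vs ≡ 0V
    comb[x⊖y]≡0V = begin
      combᵥ (x ⊖ y) vs          ≡⟨ combᵥ-⊖ x y vs ⟩
      combᵥ x vs ⊖ combᵥ y vs   ≡⟨ cong (_⊖ combᵥ y vs) combᵥ-x≡combᵥ-y ⟩
      combᵥ y vs ⊖ combᵥ y vs   ≡⟨ ⊖-inverseʳ _ ⟩
      0V                        ∎

affinelyDependent : (ps : List (Point n)) → ℕ.suc n < L.length ps → ¬ AffinelyIndependent ps
affinelyDependent ps n+1<|ps| independent
  with linearlyDependent (L.map (1F ∷_) ps) (subst (_ <_) (sym (Listₚ.length-map _ ps)) n+1<|ps|)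
... | x , x≢0V , comb≡0V =
  x≢0V (allZero⇒≡0V x (independent cs |cs|≡|ps| (proj₁ homogeneous) (proj₂ homogeneous)))
  where
    cs = toList x
    |cs|≡|ps| : L.length cs ≡ L.length ps
    |cs|≡|ps| = trans (Vecₚ.length-toList x) (Listₚ.length-map _ ps)
    homogeneous : sumF cs ≡ 0F × comb cs ps ≡ 0V
    homogeneous = Vecₚ.∷-injective (trans (sym (comb-map-∷ 1F cs ps |cs|≡|ps|)) comb≡0V)

-- Caps and the standard frame

∈-take : ∀ {A : Set} k {xs : List A} {x} → x ∈ L.take k xs → x ∈ xs
∈-take (ℕ.suc k) {_ L.∷ _} (here x≡y) = here x≡y
∈-take (ℕ.suc k) {_ L.∷ _} (there x∈xs) = there (∈-take k x∈xs)

2+n≤d+2 : n ≤ d → ℕ.suc (ℕ.suc n) ≤ d ℕ.+ 2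
2+n≤d+2 {n} {d} n≤d = subst (ℕ.suc (ℕ.suc n) ≤_) (ℕₚ.+-comm 2 d) (s≤s (s≤s n≤d))

cap-length≤ : {C : List (Point n)} → n ≤ d → IsCap d n C → L.length C ≤ ℕ.suc n
cap-length≤ {n} {C = C} n≤d (C-unique , independent) with L.length C ℕₚ.≤? ℕ.suc n
... | yes |C|≤n+1 = |C|≤n+1
... | no |C|≰n+1 = contradiction
  (independent S (Uniqueₚ.take⁺ _ C-unique) (∈-take _)
     (ℕₚ.≤-trans (ℕₚ.≤-reflexive |S|≡n+2) (2+n≤d+2 n≤d)))
  (affinelyDependent S (ℕₚ.≤-reflexive (sym |S|≡n+2)))
  where
    S = L.take (ℕ.suc (ℕ.suc n)) C
    |S|≡n+2 : L.length S ≡ ℕ.suc (ℕ.suc n)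
    |S|≡n+2 = trans (Listₚ.length-take _ C) (ℕₚ.m≤n⇒m⊓n≡m (ℕₚ.≰⇒> |C|≰n+1))

unit : Fin n → Point n
unit zero = 1F ∷ 0V
unit (suc i) = 0F ∷ unit i

standardFrame : (n : ℕ) → List (Point n)
standardFrame n = 0V L.∷ L.tabulate unit

unit-injective : unit i ≡ unit j → i ≡ j
unit-injective {i = zero} {zero} _ = refl
unit-injective {i = suc i} {suc j} eq = cong suc (unit-injective (Vecₚ.∷-injectiveʳ eq))

0V≢unit : (i : Fin n) → 0V ≢ unit i
0V≢unit (suc i) eq = 0V≢unit i (Vecₚ.∷-injectiveʳ eq)

lookup-unit-≡ : (i : Fin n) → V.lookup (unit i) i ≡ 1F
lookup-unit-≡ zero = refl
lookup-unit-≡ (suc i) = lookup-unit-≡ i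

lookup-unit-≢ : (i j : Fin n) → i ≢ j → V.lookup (unit i) j ≡ 0F
lookup-unit-≢ zero zero i≢j = contradiction refl i≢j
lookup-unit-≢ zero (suc j) _ = Vecₚ.lookup-replicate j 0F
lookup-unit-≢ (suc i) zero _ = refl
lookup-unit-≢ (suc i) (suc j) i≢j = lookup-unit-≢ i j (i≢j ∘ cong suc)

standardFrame-unique : Unique (standardFrame n)
standardFrame-unique = Allₚ.tabulate⁺ 0V≢unit ∷ᵘ Uniqueₚ.tabulate⁺ unit-injective

_≟ᵥ_ : (u v : Point n) → Dec (u ≡ v)
_≟ᵥ_ = Vecₚ.≡-dec _≟_

coeffAt : List F₃ → List (Point n) → Point n → F₃
coeffAt (c L.∷ cs) (s L.∷ S) x = (if does (s ≟ᵥ x) then c else 0F) +₃ coeffAt cs S x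
coeffAt _ _ _ = 0F

coeffAt-there : ∀ c cs {s S} {x : Point n} → s ≢ x →
  coeffAt (c L.∷ cs) (s L.∷ S) x ≡ coeffAt cs S x
coeffAt-there c cs {s} {S} {x} s≢x =
  cong (λ b → (if b then c else 0F) +₃ coeffAt cs S x) (dec-false (s ≟ᵥ x) s≢x)

coeffAt-∉ : ∀ cs {S} {x : Point n} → All (_≢ x) S → coeffAt cs S x ≡ 0F
coeffAt-∉ L.[] _ = refl
coeffAt-∉ (c L.∷ cs) []ᵃ = refl
coeffAt-∉ (c L.∷ cs) (s≢x ∷ᵃ S∌x) = trans (coeffAt-there c cs s≢x) (coeffAt-∉ cs S∌x)

coeffAt-here : ∀ c cs {S} {s : Point n} → All (s ≢_) S → coeffAt (c L.∷ cs) (s L.∷ S) s ≡ c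
coeffAt-here c cs {S} {s} S∌s = begin
  (if does (s ≟ᵥ s) then c else 0F) +₃ coeffAt cs S s
    ≡⟨ cong (λ b → (if b then c else 0F) +₃ coeffAt cs S s) (dec-true (s ≟ᵥ s) refl) ⟩
  c +₃ coeffAt cs S s
    ≡⟨ cong (c +₃_) (coeffAt-∉ cs (All.map ≢-sym S∌s)) ⟩
  c +₃ 0F
    ≡⟨ +₃-identityʳ c ⟩
  c ∎
  where open ≡-Reasoning

coeffAt-tail : ∀ c cs {s S} {x : Point n} → All (s ≢_) S → x ∈ S →
  coeffAt (c L.∷ cs) (s L.∷ S) x ≡ coeffAt cs S x
coeffAt-tail c cs S∌s x∈S = coeffAt-there c cs (All.lookup S∌s x∈S)

coeffAt≡0⇒allZero : ∀ {cs} {S : List (Point n)} → Unique S → L.length cs ≡ L.length S →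
  (∀ {x} → x ∈ S → coeffAt cs S x ≡ 0F) → All (_≡ 0F) cs
coeffAt≡0⇒allZero {cs = L.[]} {L.[]} _ _ _ = []ᵃ
coeffAt≡0⇒allZero {cs = c L.∷ cs} {s L.∷ S} (S∌s ∷ᵘ S-unique) |cs|≡|S| vanish =
  trans (sym (coeffAt-here c cs S∌s)) (vanish (here refl)) ∷ᵃ
  coeffAt≡0⇒allZero S-unique (ℕₚ.suc-injective |cs|≡|S|)
    (λ x∈S → trans (sym (coeffAt-tail c cs S∌s x∈S)) (vanish (there x∈S)))

coeffAt≡0-off⇒allZero : ∀ (p : Point n) {cs S} → Unique S → L.length cs ≡ L.length S →
  (∀ {x} → x ∈ S → x ≢ p → coeffAt cs S x ≡ 0F) → sumF cs ≡ 0F → All (_≡ 0F) cs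
coeffAt≡0-off⇒allZero p {L.[]} {L.[]} _ _ _ _ = []ᵃ
coeffAt≡0-off⇒allZero p {c L.∷ cs} {s L.∷ S} (S∌s ∷ᵘ S-unique) |cs|≡|S| vanish Σ≡0
  with s ≟ᵥ p
... | no s≢p with trans (sym (coeffAt-here c cs S∌s)) (vanish (here refl) s≢p)
...   | refl = refl ∷ᵃ coeffAt≡0-off⇒allZero p S-unique (ℕₚ.suc-injective |cs|≡|S|)
                 (λ x∈S x≢p → trans (sym (coeffAt-tail c cs S∌s x∈S)) (vanish (there x∈S) x≢p)) Σ≡0
coeffAt≡0-off⇒allZero p {c L.∷ cs} {s L.∷ S} (S∌s ∷ᵘ S-unique) |cs|≡|S| vanish Σ≡0
    | yes refl =
  trans (sym (trans (cong (c +₃_) (sumF-allZero rest)) (+₃-identityʳ c))) Σ≡0 ∷ᵃ rest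
  where
    rest : All (_≡ 0F) cs
    rest = coeffAt≡0⇒allZero S-unique (ℕₚ.suc-injective |cs|≡|S|) λ x∈S →
      trans (sym (coeffAt-tail c cs S∌s x∈S)) (vanish (there x∈S) (≢-sym (All.lookup S∌s x∈S)))

lookup-standardFrame : {s : Point n} → s ∈ standardFrame n → (j : Fin n) → s ≢ unit j →
  V.lookup s j ≡ 0F
lookup-standardFrame (here refl) j _ = Vecₚ.lookup-replicate j 0F
lookup-standardFrame (there s∈units) j s≢uj with ∈-tabulate⁻ s∈units
... | i , refl = lookup-unit-≢ i j (s≢uj ∘ cong unit)

scaled-lookup-standardFrame : ∀ c {s : Point n} → s ∈ standardFrame n → (j : Fin n) →
  c *₃ V.lookup s j ≡ (if does (s ≟ᵥ unit j) then c else 0F)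
scaled-lookup-standardFrame c {s} s∈frame j with s ≟ᵥ unit j
... | yes refl = trans (cong (c *₃_) (lookup-unit-≡ j)) (*₃-identityʳ c)
... | no s≢uj = trans (cong (c *₃_) (lookup-standardFrame s∈frame j s≢uj)) (*₃-zeroʳ c)

lookup-comb-standardFrame : ∀ cs (S : List (Point n)) → (∀ {x} → x ∈ S → x ∈ standardFrame n) →
  (j : Fin n) → V.lookup (comb cs S) j ≡ coeffAt cs S (unit j)
lookup-comb-standardFrame L.[] S _ j = Vecₚ.lookup-replicate j 0F
lookup-comb-standardFrame (c L.∷ cs) L.[] _ j = Vecₚ.lookup-replicate j 0F
lookup-comb-standardFrame (c L.∷ cs) (s L.∷ S) S⊆frame j = begin
  V.lookup ((c ⊙ s) ⊕ comb cs S) j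
    ≡⟨ Vecₚ.lookup-zipWith _+₃_ j (c ⊙ s) (comb cs S) ⟩
  V.lookup (c ⊙ s) j +₃ V.lookup (comb cs S) j
    ≡⟨ cong₂ _+₃_ (Vecₚ.lookup-map j (c *₃_) s)
                  (lookup-comb-standardFrame cs S (S⊆frame ∘ there) j) ⟩
  (c *₃ V.lookup s j) +₃ coeffAt cs S (unit j)
    ≡⟨ cong (_+₃ _) (scaled-lookup-standardFrame c (S⊆frame (here refl)) j) ⟩
  coeffAt (c L.∷ cs) (s L.∷ S) (unit j) ∎
  where open ≡-Reasoning

-- The j-th coordinate of a combination of frame points is the coefficient of eⱼ, and the
-- coefficient of 0 is then forced by the coefficients summing to 0.
standardFrame-isCap : ∀ d n → IsCap d n (standardFrame n)
standardFrame-isCap d n =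
  standardFrame-unique , λ S S-unique S⊆frame _ cs |cs|≡|S| Σ≡0 comb≡0 →
    coeffAt≡0-off⇒allZero 0V S-unique |cs|≡|S| (vanish {S} {cs} S⊆frame comb≡0) Σ≡0
  where
    vanish : ∀ {S cs} → (∀ {x} → x ∈ S → x ∈ standardFrame n) → comb cs S ≡ 0V →
      ∀ {x} → x ∈ S → x ≢ 0V → coeffAt cs S x ≡ 0F
    vanish {S} {cs} S⊆frame comb≡0 x∈S x≢0 with S⊆frame x∈S
    ... | here x≡0 = contradiction x≡0 x≢0
    ... | there x∈units with ∈-tabulate⁻ x∈units
    ...   | j , refl = begin
      coeffAt cs S (unit j)       ≡⟨ sym (lookup-comb-standardFrame cs S S⊆frame j) ⟩
      V.lookup (comb cs S) j      ≡⟨ cong (λ v → V.lookup v j) comb≡0 ⟩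
      V.lookup 0V j               ≡⟨ Vecₚ.lookup-replicate j 0F ⟩
      0F                          ∎
      where open ≡-Reasoning

-- Linear automorphisms and their matrices

record Linear (f : Point n → Point n) : Set where
  field
    ⊕-homo : ∀ u v → f (u ⊕ v) ≡ f u ⊕ f v
    ⊙-homo : ∀ a u → f (a ⊙ u) ≡ a ⊙ f u

  0V-homo : f 0V ≡ 0V
  0V-homo = trans (cong f (sym (⊙-zeroˡ 0V))) (trans (⊙-homo 0F 0V) (⊙-zeroˡ (f 0V)))

  comb-homo : ∀ cs ps → f (comb cs ps) ≡ comb cs (L.map f ps)
  comb-homo L.[] ps = 0V-homo
  comb-homo (c L.∷ cs) L.[] = 0V-homo
  comb-homo (c L.∷ cs) (p L.∷ ps) =
    trans (⊕-homo _ _) (cong₂ _⊕_ (⊙-homo c p) (comb-homo cs ps))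

open Linear

Linear-∘ : {f g : Point n → Point n} → Linear g → Linear f → Linear (g ∘ f)
Linear-∘ {f = f} {g} g-linear f-linear = record
  { ⊕-homo = λ u v → trans (cong g (⊕-homo f-linear u v)) (⊕-homo g-linear (f u) (f v))
  ; ⊙-homo = λ a u → trans (cong g (⊙-homo f-linear a u)) (⊙-homo g-linear a (f u))
  }

combᵥ-unit : (x : Point n) → combᵥ x (L.tabulate unit) ≡ x
combᵥ-unit [] = refl
combᵥ-unit (a ∷ x) = begin
  (a ⊙ (1F ∷ 0V)) ⊕ combᵥ x (L.tabulate (λ i → 0F ∷ unit i))
    ≡⟨ cong (λ ps → (a ⊙ (1F ∷ 0V)) ⊕ combᵥ x ps) (sym (Listₚ.map-tabulate unit (0F ∷_))) ⟩
  (a ⊙ (1F ∷ 0V)) ⊕ comb (toList x) (L.map (0F ∷_) (L.tabulate unit))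
    ≡⟨ cong ((a ⊙ (1F ∷ 0V)) ⊕_) (comb-map-∷ 0F (toList x) _ |x|≡n) ⟩
  (a ⊙ (1F ∷ 0V)) ⊕ (0F ∷ combᵥ x (L.tabulate unit))
    ≡⟨ cong (λ v → (a ⊙ (1F ∷ 0V)) ⊕ (0F ∷ v)) (combᵥ-unit x) ⟩
  ((a *₃ 1F) +₃ 0F) ∷ ((a ⊙ 0V) ⊕ x)
    ≡⟨ cong₂ _∷_ (trans (+₃-identityʳ _) (*₃-identityʳ a))
                 (trans (cong (_⊕ x) (⊙-zeroʳ a)) (⊕-identityˡ x)) ⟩
  a ∷ x ∎
  where
    open ≡-Reasoning
    |x|≡n = trans (Vecₚ.length-toList x) (sym (Listₚ.length-tabulate unit))

tabulate-combᵥ-unit : (us : List (Point m)) → L.length us ≡ n →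
  L.tabulate (λ (i : Fin n) → combᵥ (unit i) us) ≡ us
tabulate-combᵥ-unit {n = ℕ.zero} L.[] _ = refl
tabulate-combᵥ-unit {n = ℕ.suc n} (u L.∷ us) |us|≡n = cong₂ L._∷_ first rest
  where
    first : (1F ⊙ u) ⊕ combᵥ (0V {n}) us ≡ u
    first = trans (cong₂ _⊕_ (⊙-identityˡ u) (combᵥ-0V n us)) (⊕-identityʳ u)
    rest : L.tabulate (λ i → (0F ⊙ u) ⊕ combᵥ (unit i) us) ≡ us
    rest = trans (Listₚ.tabulate-cong λ i → trans (cong (_⊕ _) (⊙-zeroˡ u)) (⊕-identityˡ _))
                 (tabulate-combᵥ-unit us (ℕₚ.suc-injective |us|≡n))

matrixOf : (Point n → Point n) → Matrix n
matrixOf f = V.tabulate λ j → V.tabulate λ i → V.lookup (f (unit i)) j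

dot-tabulate : (g : Fin m → Point n) (j : Fin n) (x : Vec F₃ m) →
  dot (V.tabulate λ i → V.lookup (g i) j) x ≡ V.lookup (combᵥ x (L.tabulate g)) j
dot-tabulate g j [] = sym (Vecₚ.lookup-replicate j 0F)
dot-tabulate g j (a ∷ x) = begin
  (V.lookup (g zero) j *₃ a) +₃ dot (V.tabulate λ i → V.lookup (g (suc i)) j) x
    ≡⟨ cong₂ _+₃_ (*₃-comm _ a) (dot-tabulate (g ∘ suc) j x) ⟩
  (a *₃ V.lookup (g zero) j) +₃ V.lookup (combᵥ x (L.tabulate (g ∘ suc))) j
    ≡⟨ cong (_+₃ _) (sym (Vecₚ.lookup-map j (a *₃_) (g zero))) ⟩
  V.lookup (a ⊙ g zero) j +₃ V.lookup (combᵥ x (L.tabulate (g ∘ suc))) j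
    ≡⟨ sym (Vecₚ.lookup-zipWith _+₃_ j (a ⊙ g zero) _) ⟩
  V.lookup (combᵥ (a ∷ x) (L.tabulate g)) j ∎
  where open ≡-Reasoning

matrixOf-▸ : {f : Point n → Point n} → Linear f → ∀ x → matrixOf f ▸ x ≡ f x
matrixOf-▸ {f = f} f-linear x = begin
  V.map (λ row → dot row x) (V.tabulate rows)
    ≡⟨ sym (Vecₚ.tabulate-∘ _ rows) ⟩
  V.tabulate (λ j → dot (rows j) x)
    ≡⟨ Vecₚ.tabulate-cong (λ j → dot-tabulate (f ∘ unit) j x) ⟩
  V.tabulate (V.lookup (combᵥ x (L.tabulate (f ∘ unit))))
    ≡⟨ Vecₚ.tabulate∘lookup _ ⟩
  combᵥ x (L.tabulate (f ∘ unit))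
    ≡⟨ cong (combᵥ x) (sym (Listₚ.map-tabulate unit f)) ⟩
  combᵥ x (L.map f (L.tabulate unit))
    ≡⟨ sym (comb-homo f-linear (toList x) _) ⟩
  f (combᵥ x (L.tabulate unit))
    ≡⟨ cong f (combᵥ-unit x) ⟩
  f x ∎
  where
    open ≡-Reasoning
    rows = λ j → V.tabulate λ i → V.lookup (f (unit i)) j

matrixOf-▸-inverse : {f g : Point n → Point n} → Linear f → Linear g → (∀ x → g (f x) ≡ x) →
  ∀ x → matrixOf g ▸ (matrixOf f ▸ x) ≡ x
matrixOf-▸-inverse {g = g} f-linear g-linear g∘f≗id x =
  trans (matrixOf-▸ g-linear _) (trans (cong g (matrixOf-▸ f-linear x)) (g∘f≗id x))

record LinearAutomorphism (n : ℕ) : Set where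
  field
    to from : Point n → Point n
    to-linear : Linear to
    from-to : ∀ x → from (to x) ≡ x
    to-from : ∀ y → to (from y) ≡ y

  from-linear : Linear from
  from-linear = record
    { ⊕-homo = λ u v → begin
        from (u ⊕ v)
          ≡⟨ cong from (cong₂ _⊕_ (sym (to-from u)) (sym (to-from v))) ⟩
        from (to (from u) ⊕ to (from v))
          ≡⟨ cong from (sym (⊕-homo to-linear (from u) (from v))) ⟩
        from (to (from u ⊕ from v))
          ≡⟨ from-to _ ⟩
        from u ⊕ from v ∎
    ; ⊙-homo = λ a u → begin
        from (a ⊙ u)             ≡⟨ cong (λ v → from (a ⊙ v)) (sym (to-from u)) ⟩
        from (a ⊙ to (from u))   ≡⟨ cong from (sym (⊙-homo to-linear a (from u))) ⟩
        from (to (a ⊙ from u))   ≡⟨ from-to _ ⟩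
        a ⊙ from u               ∎
    }
    where open ≡-Reasoning

open LinearAutomorphism

_⁻¹ : LinearAutomorphism n → LinearAutomorphism n
F ⁻¹ = record
  { to = from F ; from = to F ; to-linear = from-linear F ; from-to = to-from F ; to-from = from-to F }

_∘ₐ_ : LinearAutomorphism n → LinearAutomorphism n → LinearAutomorphism n
G ∘ₐ F = record
  { to = to G ∘ to F
  ; from = from F ∘ from G
  ; to-linear = Linear-∘ (to-linear G) (to-linear F)
  ; from-to = λ x → trans (cong (from F) (from-to G (to F x))) (from-to F x)
  ; to-from = λ y → trans (cong (to G) (to-from F (from G y))) (to-from G y)
  }

affineTransformation : LinearAutomorphism n → Point n → AffineTransformation n
affineTransformation F b = record
  { A = matrixOf (to F)
  ; b = b
  ; invertible = matrixOf (from F)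
               , matrixOf-▸-inverse (to-linear F) (from-linear F) (from-to F)
               , matrixOf-▸-inverse (from-linear F) (to-linear F) (to-from F)
  }

apply-affineTransformation : (F : LinearAutomorphism n) (b x : Point n) →
  AffineTransformation.apply (affineTransformation F b) x ≡ to F x ⊕ b
apply-affineTransformation F b x = cong (_⊕ b) (matrixOf-▸ (to-linear F) x)

-- Affine frames

LinearlyIndependent : List (Point n) → Set
LinearlyIndependent us = ∀ cs → L.length cs ≡ L.length us → comb cs us ≡ 0V → All (_≡ 0F) cs

combᵥ-injective : {us : List (Point n)} → LinearlyIndependent us →
  (x y : Vec F₃ m) → m ≡ L.length us → combᵥ x us ≡ combᵥ y us → x ≡ y
combᵥ-injective {us = us} independent x y m≡|us| same =
  ⊖≡0⇒≡ x y (allZero⇒≡0V (x ⊖ y)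
    (independent (toList (x ⊖ y)) (trans (Vecₚ.length-toList (x ⊖ y)) m≡|us|) comb[x⊖y]≡0V))
  where
    comb[x⊖y]≡0V : combᵥ (x ⊖ y) us ≡ 0V
    comb[x⊖y]≡0V = trans (combᵥ-⊖ x y us) (trans (cong (_⊖ combᵥ y us) same) (⊖-inverseʳ _))

combᵥ-surjective : {us : List (Point n)} → L.length us ≡ n → LinearlyIndependent us →
  ∀ y → ∃ λ (x : Point n) → combᵥ x us ≡ y
combᵥ-surjective {us = us} |us|≡n independent y
  with linearlyDependent (y L.∷ us) (ℕₚ.≤-reflexive (cong ℕ.suc (sym |us|≡n)))
... | a ∷ z , az≢0V , a⊙y⊕Z≡0 with a ≟ 0F
...   | yes refl =
  contradiction (cong (0F ∷_) (combᵥ-injective independent z 0V refl Z≡combᵥ0V)) az≢0V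
  where
    open ≡-Reasoning
    Z≡combᵥ0V : combᵥ z us ≡ combᵥ (0V {L.length us}) us
    Z≡combᵥ0V = begin
      combᵥ z us                    ≡⟨ sym (⊕-identityˡ _) ⟩
      0V ⊕ combᵥ z us               ≡⟨ cong (_⊕ combᵥ z us) (sym (⊙-zeroˡ y)) ⟩
      (0F ⊙ y) ⊕ combᵥ z us         ≡⟨ a⊙y⊕Z≡0 ⟩
      0V                            ≡⟨ sym (combᵥ-0V (L.length us) us) ⟩
      combᵥ (0V {L.length us}) us   ∎
-- a ⊙ y = −Z, and in F₃ the inverse of a nonzero a is a itself and −1 = 2.
...   | no a≢0 = V.cast |us|≡n ((a *₃ 2F) ⊙ z) , (begin
  combᵥ (V.cast |us|≡n ((a *₃ 2F) ⊙ z)) us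
    ≡⟨ cong (λ cs → comb cs us) (Vecₚ.toList-cast |us|≡n _) ⟩
  combᵥ ((a *₃ 2F) ⊙ z) us
    ≡⟨ combᵥ-⊙ (a *₃ 2F) z us ⟩
  (a *₃ 2F) ⊙ combᵥ z us
    ≡⟨ ⊙-assoc a 2F _ ⟩
  a ⊙ (2F ⊙ combᵥ z us)
    ≡⟨ cong (a ⊙_) (sym (⊕-inverse-unique (a ⊙ y) _ a⊙y⊕Z≡0)) ⟩
  a ⊙ (a ⊙ y)
    ≡⟨ sym (⊙-assoc a a y) ⟩
  (a *₃ a) ⊙ y
    ≡⟨ cong (_⊙ y) (*₃-selfInverse a a≢0) ⟩
  1F ⊙ y
    ≡⟨ ⊙-identityˡ y ⟩
  y ∎)
  where open ≡-Reasoning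

coordinateAutomorphism : (us : List (Point n)) → L.length us ≡ n → LinearlyIndependent us →
  LinearAutomorphism n
coordinateAutomorphism us |us|≡n independent = record
  { to = λ x → combᵥ x us
  ; from = λ y → proj₁ (spans y)
  ; to-linear = record { ⊕-homo = λ u v → combᵥ-⊕ u v us ; ⊙-homo = λ a u → combᵥ-⊙ a u us }
  ; from-to = λ x → combᵥ-injective independent _ x (sym |us|≡n) (proj₂ (spans (combᵥ x us)))
  ; to-from = λ y → proj₂ (spans y)
  }
  where
    spans = combᵥ-surjective |us|≡n independent

differences-independent : {c₀ : Point n} {cs : List (Point n)} →
  AffinelyIndependent (c₀ L.∷ cs) → LinearlyIndependent (L.map (_⊖ c₀) cs)
differences-independent {c₀ = c₀} {cs} independent bs |bs|≡|us| comb≡0 =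
  All.tail (independent (2F *₃ sumF bs L.∷ bs) (cong ℕ.suc |bs|≡|cs|)
                        (+₃-inverseˡ (sumF bs)) combined≡0)
  where
    open ≡-Reasoning
    |bs|≡|cs| = trans |bs|≡|us| (Listₚ.length-map _ cs)
    combined≡0 : ((2F *₃ sumF bs) ⊙ c₀) ⊕ comb bs cs ≡ 0V
    combined≡0 = begin
      ((2F *₃ sumF bs) ⊙ c₀) ⊕ comb bs cs
        ≡⟨ ⊕-comm _ _ ⟩
      comb bs cs ⊕ ((2F *₃ sumF bs) ⊙ c₀)
        ≡⟨ cong (λ a → comb bs cs ⊕ (a ⊙ c₀)) (*₃-comm 2F (sumF bs)) ⟩
      comb bs cs ⊕ ((sumF bs *₃ 2F) ⊙ c₀)
        ≡⟨ cong (comb bs cs ⊕_) (⊙-assoc (sumF bs) 2F c₀) ⟩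
      comb bs cs ⊕ (sumF bs ⊙ (2F ⊙ c₀))
        ≡⟨ sym (comb-map-⊕ʳ bs cs (2F ⊙ c₀) |bs|≡|cs|) ⟩
      comb bs (L.map (_⊖ c₀) cs)
        ≡⟨ comb≡0 ⟩
      0V ∎

frameAutomorphism : {c₀ : Point n} {cs : List (Point n)} →
  L.length cs ≡ n → AffinelyIndependent (c₀ L.∷ cs) → LinearAutomorphism n
frameAutomorphism {c₀ = c₀} {cs} |cs|≡n independent =
  coordinateAutomorphism (L.map (_⊖ c₀) cs) (trans (Listₚ.length-map _ cs) |cs|≡n)
                         (differences-independent independent)

frameAutomorphism-standardFrame : {c₀ : Point n} {cs : List (Point n)} →
  (|cs|≡n : L.length cs ≡ n) (independent : AffinelyIndependent (c₀ L.∷ cs)) →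
  L.map (λ x → to (frameAutomorphism |cs|≡n independent) x ⊕ c₀) (standardFrame n) ≡ c₀ L.∷ cs
frameAutomorphism-standardFrame {n} {c₀} {cs} |cs|≡n _ = cong₂ L._∷_ image-0V (begin
  L.map (λ x → combᵥ x us ⊕ c₀) (L.tabulate unit)
    ≡⟨ Listₚ.map-tabulate unit _ ⟩
  L.tabulate (λ i → combᵥ (unit i) us ⊕ c₀)
    ≡⟨ sym (Listₚ.map-tabulate (λ i → combᵥ (unit i) us) (_⊕ c₀)) ⟩
  L.map (_⊕ c₀) (L.tabulate (λ i → combᵥ (unit i) us))
    ≡⟨ cong (L.map (_⊕ c₀)) (tabulate-combᵥ-unit us |us|≡n) ⟩
  L.map (_⊕ c₀) (L.map (_⊖ c₀) cs)
    ≡⟨ sym (Listₚ.map-∘ cs) ⟩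
  L.map (λ c → (c ⊖ c₀) ⊕ c₀) cs
    ≡⟨ Listₚ.map-cong (λ c → ⊖-⊕-cancel c c₀) cs ⟩
  L.map (λ c → c) cs
    ≡⟨ Listₚ.map-id cs ⟩
  cs ∎)
  where
    open ≡-Reasoning
    us = L.map (_⊖ c₀) cs
    |us|≡n = trans (Listₚ.length-map _ cs) |cs|≡n
    image-0V : combᵥ (0V {n}) us ⊕ c₀ ≡ c₀
    image-0V = trans (cong (_⊕ c₀) (combᵥ-0V n us)) (⊕-identityˡ c₀)

map⇒affinelyEquivalent : (T : AffineTransformation n) {C D : List (Point n)} →
  L.map (AffineTransformation.apply T) C ≡ D → AffinelyEquivalent C D
map⇒affinelyEquivalent T refl = T , λ x → mk⇔
  (λ x∈TC → let y , y∈C , x≡Ty = ∈-map⁻ _ x∈TC in y , y∈C , sym x≡Ty)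
  (λ { (y , y∈C , Ty≡x) → subst (_∈ _) Ty≡x (∈-map⁺ _ y∈C) })

affinelyIndependent-equivalent : {C D : List (Point n)} →
  L.length C ≡ ℕ.suc n → L.length D ≡ ℕ.suc n →
  AffinelyIndependent C → AffinelyIndependent D → AffinelyEquivalent C D
affinelyIndependent-equivalent {n} {c₀ L.∷ cs} {d₀ L.∷ ds} |C|≡n+1 |D|≡n+1 C-indep D-indep =
  map⇒affinelyEquivalent T (begin
    L.map (apply T) (c₀ L.∷ cs)
      ≡⟨ cong (L.map (apply T)) (sym (frameAutomorphism-standardFrame |cs|≡n C-indep)) ⟩
    L.map (apply T) (L.map (λ x → to F x ⊕ c₀) (standardFrame n))
      ≡⟨ sym (Listₚ.map-∘ (standardFrame n)) ⟩
    L.map (λ x → apply T (to F x ⊕ c₀)) (standardFrame n)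
      ≡⟨ Listₚ.map-cong T∘F≗G (standardFrame n) ⟩
    L.map (λ x → to G x ⊕ d₀) (standardFrame n)
      ≡⟨ frameAutomorphism-standardFrame |ds|≡n D-indep ⟩
    d₀ L.∷ ds ∎)
  where
    open ≡-Reasoning
    open AffineTransformation using (apply)
    |cs|≡n = ℕₚ.suc-injective |C|≡n+1
    |ds|≡n = ℕₚ.suc-injective |D|≡n+1
    F = frameAutomorphism |cs|≡n C-indep
    G = frameAutomorphism |ds|≡n D-indep
    L = G ∘ₐ (F ⁻¹)
    T = affineTransformation L (d₀ ⊖ to L c₀)
    T∘F≗G : ∀ x → apply T (to F x ⊕ c₀) ≡ to G x ⊕ d₀
    T∘F≗G x = begin
      apply T (to F x ⊕ c₀)
        ≡⟨ apply-affineTransformation L _ _ ⟩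
      to L (to F x ⊕ c₀) ⊕ (d₀ ⊖ to L c₀)
        ≡⟨ cong (_⊕ (d₀ ⊖ to L c₀)) (⊕-homo (to-linear L) _ _) ⟩
      (to L (to F x) ⊕ to L c₀) ⊕ (d₀ ⊖ to L c₀)
        ≡⟨ ⊕-⊖-cancel _ _ _ ⟩
      to G (from F (to F x)) ⊕ d₀
        ≡⟨ cong (λ v → to G v ⊕ d₀) (from-to F x) ⟩
      to G x ⊕ d₀ ∎

maximalCap-length : {C : List (Point n)} → n ≤ d → IsMaximalCap d n C → L.length C ≡ ℕ.suc n
maximalCap-length {n} {d} {C} n≤d (C-cap , C-maximal) =
  ℕₚ.≤-antisym (cap-length≤ n≤d C-cap)
    (subst (_≤ L.length C) (cong ℕ.suc (Listₚ.length-tabulate unit))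
           (C-maximal (standardFrame n) (standardFrame-isCap d n)))

maximalCap-affinelyIndependent : {C : List (Point n)} → n ≤ d → IsMaximalCap d n C →
  AffinelyIndependent C
maximalCap-affinelyIndependent n≤d C-maximal@((C-unique , small-subsets-independent) , _) =
  small-subsets-independent _ C-unique (λ x∈C → x∈C)
    (ℕₚ.≤-trans (ℕₚ.≤-reflexive (maximalCap-length n≤d C-maximal))
                (ℕₚ.≤-trans (ℕₚ.n≤1+n _) (2+n≤d+2 n≤d)))

corollary2p3 : (d n : ℕ) → n ≤ d → (C D : List (Point n)) →
    IsMaximalCap d n C → IsMaximalCap d n D → AffinelyEquivalent C D
corollary2p3 d n n≤d C D C-maximal D-maximal =
  affinelyIndependent-equivalent
    (maximalCap-length n≤d C-maximal) (maximalCap-length n≤d D-maximal)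
    (maximalCap-affinelyIndependent n≤d C-maximal) (maximalCap-affinelyIndependent n≤d D-maximal)
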